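{- A DR-net $\pi$ is in $\mathbf{L^3}$ iff all cycles in its $\mathbin{⅋}$-closure $\pi_0$ are $!?$-balanced.
   Context: Nets are built from links axiom, cut, one, bottom, tensor, par (conclusion $A\mathbin{⅋}B$), flat (premise $A$, conclusion $\flat A$), pax, why not (premises $\flat A$, conclusion $?A$), of course (premise $A$, conclusion $!A$), paragraph (premise $A$, conclusion $\S A$), with boxes (of course principal port, pax auxiliary ports). A switching keeps exactly one premise of each par and why not link and collapses depth-zero boxes to nodes; a net is DR-correct if all switchings are acyclic and so are (recursively) the contents of boxes; a DR-net is a DR-correct net with no $\flat$-formula among its conclusions. An exponential indexing of a net is a function $I$ from edges to $\mathbb Z$ such that both conclusions of an axiom and both premises of a cut have equal index; premises and conclusion of one, bottom, tensor, par, flat and pax links have equal index; for paragraph, of course and why not links, all premises have index $I(e')+1$ where $e'$ is the conclusion; and all conclusions of the net have the same index. $\mathbf{L^3}$ (linear logic by levels) is the set of DR-nets admitting an exponential indexing. The $\mathbin{⅋}$-closure of a net with conclusions $A_1,\ldots,A_n$ is obtained by adding a tree of par links producing the single conclusion $A_1\mathbin{⅋}\cdots\mathbin{⅋}A_n$. A cycle (in the underlying undirected graph) is $!?$-balanced if it traverses paragraph, of course and why not links from premise to conclusion as many times as from conclusion to premise. -}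

module Defs where

open import Data.Nat using (ℕ; zero; suc; pred; _∸_; _≟_)
open import Data.Nat.Base using (_+_)
open import Data.Integer using (ℤ; 1ℤ) renaming (_+_ to _+ℤ_)
open import Data.Fin using (Fin; zero; suc; toℕ; lower₁; fromℕ) renaming (_≟_ to _≟F_)
open import Data.Vec using (Vec; []; _∷_; lookup; map)
open import Data.List using (List; []; _∷_; length; filterᵇ)
open import Data.Nat.ListAction using (sum)
open import Data.List as List using ()
open import Data.Fin using () renaming (Fin to Fin')
open import Data.Maybe using (Maybe; just; nothing) renaming (map to mapMaybe)
open import Data.Bool using (Bool; true; false; if_then_else_; _∧_; not)
open import Data.Product using (Σ; _×_; _,_; ∃-syntax)
open import Data.Sum using (_⊎_; inj₁; inj₂)
open import Data.Empty using (⊥)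
open import Data.Unit using (⊤; tt)
open import Relation.Nullary using (¬_; yes; no)
open import Relation.Binary.PropositionalEquality using (_≡_; _≢_)
import Data.List.Base as LB

data Formula : Set where
  atom   : ℕ → Formula
  atom⊥  : ℕ → Formula
  𝟙      : Formula
  ⊥ᶠ     : Formula
  _⊗_    : Formula → Formula → Formula
  _⅋_    : Formula → Formula → Formula
  bang   : Formula → Formula
  whyNot : Formula → Formula
  sect   : Formula → Formula
  flat   : Formula → Formula

-- linear negation, as a relation (♭-formulas have no dual)
data Dual : Formula → Formula → Set where
  d-atom  : ∀ n → Dual (atom n) (atom⊥ n)
  d-atom' : ∀ n → Dual (atom⊥ n) (atom n)
  d-one   : Dual 𝟙 ⊥ᶠ
  d-bot   : Dual ⊥ᶠ 𝟙
  d-tens  : ∀ {A B A' B'} → Dual A A' → Dual B B' → Dual (A ⊗ B) (A' ⅋ B')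
  d-par   : ∀ {A B A' B'} → Dual A A' → Dual B B' → Dual (A ⅋ B) (A' ⊗ B')
  d-bang  : ∀ {A A'} → Dual A A' → Dual (bang A) (whyNot A')
  d-wn    : ∀ {A A'} → Dual A A' → Dual (whyNot A) (bang A')
  d-sect  : ∀ {A A'} → Dual A A' → Dual (sect A) (sect A')

IsFlat : Formula → Set
IsFlat (flat _) = ⊤
IsFlat _        = ⊥

data Kind : Set where
  kAx kCut kOne kBot kTensor kPar kFlat kPax kOfc kPara : Kind
  kWn : ℕ → Kind

nPrem : Kind → ℕ
nPrem kAx = 0
nPrem kCut = 2
nPrem kOne = 0
nPrem kBot = 0
nPrem kTensor = 2
nPrem kPar = 2
nPrem kFlat = 1
nPrem kPax = 1
nPrem kOfc = 1
nPrem kPara = 1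
nPrem (kWn n) = n

nConc : Kind → ℕ
nConc kAx = 2
nConc kCut = 0
nConc (kWn n) = 1
nConc kOne = 1
nConc kBot = 1
nConc kTensor = 1
nConc kPar = 1
nConc kFlat = 1
nConc kPax = 1
nConc kOfc = 1
nConc kPara = 1

Typed : (k : Kind) → Vec Formula (nPrem k) → Vec Formula (nConc k) → Set
Typed kAx [] (A ∷ B ∷ []) = Dual A B
Typed kCut (A ∷ B ∷ []) [] = Dual A B
Typed kOne [] (C ∷ []) = C ≡ 𝟙
Typed kBot [] (C ∷ []) = C ≡ ⊥ᶠ
Typed kTensor (A ∷ B ∷ []) (C ∷ []) = C ≡ (A ⊗ B)
Typed kPar (A ∷ B ∷ []) (C ∷ []) = C ≡ (A ⅋ B)
Typed kFlat (A ∷ []) (C ∷ []) = C ≡ flat A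
Typed kPax (A ∷ []) (C ∷ []) = C ≡ A
Typed kOfc (A ∷ []) (C ∷ []) = C ≡ bang A
Typed kPara (A ∷ []) (C ∷ []) = C ≡ sect A
Typed (kWn n) ps (C ∷ []) = Σ Formula λ A → (C ≡ whyNot A) × (∀ i → lookup ps i ≡ flat A)

isPax : Kind → Bool
isPax kPax = true
isPax _    = false

isExp : Kind → Bool
isExp kOfc    = true
isExp kPara   = true
isExp (kWn _) = true
isExp _       = false

record PreNet : Set where
  field
    nL nE  : ℕ
    kind   : Fin nL → Kind
    prem   : (l : Fin nL) → Vec (Fin nE) (nPrem (kind l))
    conc   : (l : Fin nL) → Vec (Fin nE) (nConc (kind l))
    label  : Fin nE → Formula
    src    : Fin nE → Fin nL            -- the link of which e is a conclusion
    tgt    : Fin nE → Maybe (Fin nL)    -- the link of which e is a premise (nothing: conclusion of the net)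
    cont   : Fin nL → Fin nL → Bool     -- cont o x : x lies (strictly) inside the box of the ! link o
    paxBox : Fin nL → Fin nL            -- for a pax link: the ! link of the box it is an auxiliary door of

module _ (π : PreNet) where
  open PreNet π

  IsDoor : Fin nL → Fin nL → Set
  IsDoor o d = (kind d ≡ kPax) × (paxBox d ≡ o)

  InBox : Fin nL → Fin nL → Set
  InBox o x = (x ≡ o) ⊎ IsDoor o x ⊎ (cont o x ≡ true)

  TgtIn : (Fin nL → Set) → Maybe (Fin nL) → Set
  TgtIn P (just l) = P l
  TgtIn P nothing  = ⊥

  record WellFormed : Set where
    field
      conc-src : ∀ l i → src (lookup (conc l) i) ≡ l
      prem-tgt : ∀ l i → tgt (lookup (prem l) i) ≡ just l
      src-conc : ∀ e → ∃[ i ] lookup (conc (src e)) i ≡ e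
      tgt-prem : ∀ e l → tgt e ≡ just l → ∃[ i ] lookup (prem l) i ≡ e
      conc-inj : ∀ l i j → lookup (conc l) i ≡ lookup (conc l) j → i ≡ j
      prem-inj : ∀ l i j → lookup (prem l) i ≡ lookup (prem l) j → i ≡ j
      typed    : ∀ l → Typed (kind l) (map label (prem l)) (map label (conc l))
      cont-ofc : ∀ o x → cont o x ≡ true → kind o ≡ kOfc
      pax-ofc  : ∀ d → kind d ≡ kPax → kind (paxBox d) ≡ kOfc
      cont-irr : ∀ o → cont o o ≡ false
      door-out : ∀ o d → IsDoor o d → cont o d ≡ false
      interface : ∀ o → kind o ≡ kOfc → ∀ e →
        (cont o (src e) ≡ true → TgtIn (InBox o) (tgt e)) ×
        (TgtIn (InBox o) (tgt e) → cont o (src e) ≡ true)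
      laminar  : ∀ o o' → kind o ≡ kOfc → kind o' ≡ kOfc → o ≢ o' →
        (∀ x → InBox o x → InBox o' x → ⊥) ⊎
        (∀ x → InBox o x → cont o' x ≡ true) ⊎
        (∀ x → InBox o' x → cont o x ≡ true)

Net : Set
Net = Σ PreNet WellFormed

record Graph : Set₁ where
  field
    V E : Set
    s   : E → V
    t   : E → Maybe V     -- nothing: pending edge (only one endpoint)

csuc : ∀ {k} → Fin (suc k) → Fin (suc k)
csuc {k} i with k ≟ toℕ i
... | yes _ = zero
... | no ne = suc (lower₁ i ne)

module _ (G : Graph) where
  open Graph G

  -- traversing an edge, forward (s → t) or backward (t → s)
  record Step : Set where
    field
      edge  : E
      other : V
      isT   : t edge ≡ just other
      fwd   : Bool

  start : Step → V
  start st = if Step.fwd st then s (Step.edge st) else Step.other st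

  end : Step → V
  end st = if Step.fwd st then Step.other st else s (Step.edge st)

  -- a simple cycle: closed walk of len+1 steps, distinct edges, distinct vertices
  record Cycle : Set where
    field
      len     : ℕ
      step    : Fin (suc len) → Step
      chain   : ∀ i → end (step i) ≡ start (step (csuc i))
      edgeInj : ∀ i j → Step.edge (step i) ≡ Step.edge (step j) → i ≡ j
      vertInj : ∀ i j → start (step i) ≡ start (step j) → i ≡ j

  Acyclic : Set
  Acyclic = Cycle → ⊥

countF : ∀ {n} → (Fin n → Bool) → ℕ
countF {n} f = sum (LB.map (λ i → if f i then 1 else 0) (LB.allFin n))

-- !?-balanced: #(premise→conclusion traversals of !,§,? links)
--             = #(conclusion→premise traversals of !,§,? links)
Balanced : (G : Graph) → (Graph.V G → Kind) → Cycle G → Set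
Balanced G κ c =
  countF (λ i → isExp (κ (end G (step i))) ∧ Step.fwd (step i) ∧ Step.fwd (step (csuc i)))
  ≡ countF (λ i → isExp (κ (end G (step i))) ∧ not (Step.fwd (step i)) ∧ not (Step.fwd (step (csuc i))))
  where open Cycle c

module _ (π : PreNet) where
  open PreNet π

  -- regions: the whole net (nothing) or the contents of the box of o (just o)
  InR : Maybe (Fin nL) → Fin nL → Set
  InR nothing  x = ⊤
  InR (just o) x = cont o x ≡ true

  ValidRegion : Maybe (Fin nL) → Set
  ValidRegion nothing  = ⊤
  ValidRegion (just o) = kind o ≡ kOfc

  -- depth zero relative to a region
  Dz : Maybe (Fin nL) → Fin nL → Set
  Dz R x = InR R x × (∀ o → InR R o → cont o x ≡ false)

  Choice : Kind → Set
  Choice kPar          = Fin 2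
  Choice (kWn (suc n)) = Fin (suc n)
  Choice _             = ⊤

  Switching : Set
  Switching = (l : Fin nL) → Choice (kind l)

  Kept : (k : Kind) → Choice k → Vec (Fin nE) (nPrem k) → Fin nE → Set
  Kept kPar c v e          = lookup v c ≡ e
  Kept (kWn (suc n)) c v e = lookup v c ≡ e
  Kept _ _ _ _             = ⊤

  SwTgt : Maybe (Fin nL) → Switching → Fin nE → Maybe (Fin nL) → Set
  SwTgt R sw e nothing  = ⊤
  SwTgt R sw e (just l) = Dz R l × Kept (kind l) (sw l) (prem l) e

  SwEdge : Maybe (Fin nL) → Switching → Fin nE → Set
  SwEdge R sw e = Dz R (src e) × SwTgt R sw e (tgt e)

  -- collapse of depth-zero boxes: auxiliary doors are identified with the principal door
  -- (links inside depth-zero boxes carry no edge of the switching graph)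
  rep : Fin nL → Fin nL
  rep x = if isPax (kind x) then paxBox x else x

  switchGraph : Maybe (Fin nL) → Switching → Graph
  switchGraph R sw = record
    { V = Fin nL
    ; E = Σ (Fin nE) (SwEdge R sw)
    ; s = λ p → rep (src (Data.Product.proj₁ p))
    ; t = λ p → mapMaybe rep (tgt (Data.Product.proj₁ p))
    }

  DRCorrect : Set
  DRCorrect = ∀ R → ValidRegion R → ∀ (sw : Switching) → Acyclic (switchGraph R sw)

DRNet : Net → Set
DRNet (π , _) = DRCorrect π × (∀ e → PreNet.tgt π e ≡ nothing → ¬ IsFlat (PreNet.label π e))

IdxOK : (k : Kind) → Vec ℤ (nPrem k) → Vec ℤ (nConc k) → Set
IdxOK kAx [] (a ∷ b ∷ []) = a ≡ b
IdxOK kCut (a ∷ b ∷ []) [] = a ≡ b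
IdxOK kOne [] (c ∷ []) = ⊤
IdxOK kBot [] (c ∷ []) = ⊤
IdxOK kTensor (a ∷ b ∷ []) (c ∷ []) = (a ≡ c) × (b ≡ c)
IdxOK kPar (a ∷ b ∷ []) (c ∷ []) = (a ≡ c) × (b ≡ c)
IdxOK kFlat (a ∷ []) (c ∷ []) = a ≡ c
IdxOK kPax (a ∷ []) (c ∷ []) = a ≡ c
IdxOK kOfc (a ∷ []) (c ∷ []) = a ≡ c +ℤ 1ℤ
IdxOK kPara (a ∷ []) (c ∷ []) = a ≡ c +ℤ 1ℤ
IdxOK (kWn n) ps (c ∷ []) = ∀ i → lookup ps i ≡ c +ℤ 1ℤ

ExpIndexing : Net → Set
ExpIndexing (π , _) = Σ (Fin nE → ℤ) λ I →
    (∀ l → IdxOK (kind l) (map I (prem l)) (map I (conc l)))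
  × (∀ e e' → tgt e ≡ nothing → tgt e' ≡ nothing → I e ≡ I e')
  where open PreNet π

L3 : Net → Set
L3 π = DRNet π × ExpIndexing π

-- Conclusions c₀ … c_{n-1} (in increasing edge order) are closed by the
-- left comb of par links P₀ … P_{n-2}: P₀ has premises c₀ c₁, P_k (k ≥ 1)
-- has premises F_{k-1} c_{k+1}, where F_k is the conclusion of P_k.

isNothing : ∀ {A : Set} → Maybe A → Bool
isNothing nothing  = true
isNothing (just _) = false

indexOf : ∀ {n} → Fin n → List (Fin n) → ℕ
indexOf x [] = 0
indexOf x (y ∷ ys) with x ≟F y
... | yes _ = 0
... | no _  = suc (indexOf x ys)

clamp : (m : ℕ) → ℕ → Fin (suc m)
clamp m zero = zero
clamp zero (suc k) = zero
clamp (suc m) (suc k) = suc (clamp m k)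

combTgtOrig : (n : ℕ) → ℕ → Maybe (Fin (pred n))
combTgtOrig zero j = nothing
combTgtOrig (suc zero) j = nothing
combTgtOrig (suc (suc m)) j = just (clamp m (j ∸ 1))

combTgtNew : (n : ℕ) → Fin (pred n) → Maybe (Fin (pred n))
combTgtNew (suc (suc m)) k with m ≟ toℕ k
... | yes _ = nothing
... | no ne = just (suc (lower₁ k ne))

module _ (π : PreNet) where
  open PreNet π

  netConcls : List (Fin nE)
  netConcls = filterᵇ (λ e → isNothing (tgt e)) (LB.allFin nE)

  nC : ℕ
  nC = length netConcls

  closTgt : Fin nE ⊎ Fin (pred nC) → Maybe (Fin nL ⊎ Fin (pred nC))
  closTgt (inj₁ e) with tgt e
  ... | just l  = just (inj₁ l)
  ... | nothing = mapMaybe inj₂ (combTgtOrig nC (indexOf e netConcls))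
  closTgt (inj₂ k) = mapMaybe inj₂ (combTgtNew nC k)

  closGraph : Graph
  closGraph = record
    { V = Fin nL ⊎ Fin (pred nC)
    ; E = Fin nE ⊎ Fin (pred nC)
    ; s = λ { (inj₁ e) → inj₁ (src e) ; (inj₂ k) → inj₂ k }
    ; t = closTgt
    }

  closKind : Graph.V closGraph → Kind
  closKind (inj₁ l) = kind l
  closKind (inj₂ _) = kPar

AllCyclesBalanced : Net → Set
AllCyclesBalanced (π , _) = ∀ (c : Cycle (closGraph π)) → Balanced (closGraph π) (closKind π) c

-- An exponential indexing is the same thing as a potential on the links of the ⅋-closure: give
-- each link the index of its conclusions; then a premise of a !, § or ? link lies one level above
-- the link and every other premise at the level of its link.  Summed around a cycle these jumps
-- telescope, which is !?-balance.  Conversely, if every simple cycle is balanced then so is every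
-- closed walk (cut it at a repeated vertex, or at an edge traversed back and forth), so the weight
-- of a path from a root, chosen in each connected component, is a well-defined potential.  The new
-- par links form a chain, which puts all conclusions of the net at one level.

module Submission where

open import Defs
open import Data.Product using (_×_; Σ; ∃-syntax; _,_; proj₁; proj₂)

open import Algebra.Bundles using (CommutativeMonoid; AbelianGroup)
import Algebra.Properties.CommutativeMonoid.Sum as CommutativeMonoidSum
open import Data.Bool using (Bool; true; false; T; if_then_else_; _∧_; not)
open import Data.Bool.Properties using (T?)
open import Data.Fin using (Fin; zero; suc; toℕ; fromℕ; inject₁) renaming (_≟_ to _≟ᶠ_)
open import Data.Fin.Properties using (toℕ-fromℕ; toℕ-inject₁-≢; lower₁-inject₁′)
open import Data.Fin.Relation.Unary.Top using (View; view; ‵fromℕ; ‵inject₁)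
open import Data.Integer as ℤ using (ℤ; +_; _⊖_; 0ℤ)
import Data.Integer.Properties as ℤ
open import Data.List using (List; []; _∷_; _++_; [_]; length; map; tabulate; lookup; allFin)
open import Data.List.Properties using (map-++; map-cong; length-++; tabulate-lookup)
open import Data.List.Membership.Propositional using (_∈_; find)
open import Data.List.Membership.Propositional.Properties
  using (∈-lookup; ∈-∃++; ∈-filter⁺; ∈-filter⁻; ∈-allFin; ∈-map⁺; ∈-++⁺ˡ; ∈-++⁺ʳ)
open import Data.List.Relation.Unary.All as All using (All; []; _∷_)
open import Data.List.Relation.Unary.All.Properties using (¬Any⇒All¬)
open import Data.List.Relation.Unary.AllPairs using (AllPairs; []; _∷_)
open import Data.List.Relation.Unary.Any using (any?; here)
open import Data.Maybe using (Maybe; just; nothing) renaming (map to mapMaybe)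
open import Data.Maybe.Properties using (just-injective)
open import Data.Nat as ℕ using (ℕ; zero; suc; pred; _+_; _∸_; _<_; _≤_; s≤s; z≤n)
import Data.Nat.Properties as ℕ
open import Data.Nat.Induction using (<-wellFounded)
open import Data.Nat.ListAction using (sum)
open import Data.Nat.ListAction.Properties using (sum-++)
open import Data.Nat.Tactic.RingSolver using (solve-∀)
open import Data.Sum using (_⊎_; inj₁; inj₂)
open import Data.Sum.Properties using (≡-dec)
open import Data.Unit using (tt)
open import Data.Vec as Vec using (Vec; []; _∷_)
open import Data.Vec.Properties using (lookup-map)
open import Function using (_∘_)
open import Induction.WellFounded using (Acc; acc)
open import Relation.Binary.Core using (Rel)
open import Relation.Binary.Definitions using (Symmetric; DecidableEquality)
open import Relation.Binary.PropositionalEquality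
  using (_≡_; _≢_; refl; sym; trans; cong; cong₂; subst; _≗_; module ≡-Reasoning)
open import Relation.Nullary using (¬_; Dec; yes; no)
open import Relation.Nullary.Negation using (contradiction)

⊖-cross : ∀ {a b c d} → a + d ≡ c + b → a ⊖ b ≡ c ⊖ d
⊖-cross {a} {b} {c} {d} eq = begin
  a ⊖ b              ≡⟨ sym (ℤ.+-cancelˡ-⊖ d a b) ⟩
  (d + a) ⊖ (d + b)  ≡⟨ cong₂ _⊖_ (trans (ℕ.+-comm d a) (trans eq (ℕ.+-comm c b))) (ℕ.+-comm d b) ⟩
  (b + c) ⊖ (b + d)  ≡⟨ ℤ.+-cancelˡ-⊖ b c d ⟩
  c ⊖ d              ∎
  where open ≡-Reasoning

lookup-injective : ∀ {a ℓ} {A : Set a} {R : Rel A ℓ} → Symmetric R → ∀ {xs} →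
                   AllPairs (λ x y → ¬ R x y) xs → ∀ i j → R (lookup xs i) (lookup xs j) → i ≡ j
lookup-injective sym-R (_ ∷ _)     zero    zero    _ = refl
lookup-injective sym-R (¬Rs ∷ _)   zero    (suc j) r = contradiction r (All.lookup ¬Rs (∈-lookup j))
lookup-injective sym-R (¬Rs ∷ _)   (suc i) zero    r = contradiction (sym-R r) (All.lookup ¬Rs (∈-lookup i))
lookup-injective sym-R (_ ∷ free)  (suc i) (suc j) r = cong suc (lookup-injective sym-R free i j r)

consecutive-constant : ∀ {A : Set} {m} (d : Fin (suc m) → A) → (∀ j → d (inject₁ j) ≡ d (suc j)) → ∀ k → d k ≡ d zero
consecutive-constant {m = zero}  d step zero    = refl
consecutive-constant {m = suc m} d step zero    = refl
consecutive-constant {m = suc m} d step (suc k) = trans (consecutive-constant (d ∘ suc) (step ∘ suc) k) (sym (step zero))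

distinct-members : ∀ {A : Set} {x y : A} {xs} → x ∈ xs → y ∈ xs → x ≢ y → 2 ≤ length xs
distinct-members {xs = _ ∷ _ ∷ _} _ _ _ = s≤s (s≤s z≤n)
distinct-members {xs = _ ∷ []} (here refl) (here refl) x≢y = contradiction refl x≢y

mapMaybe-inj₂ : ∀ {A B : Set} (m : Maybe B) {v : A ⊎ B} → mapMaybe inj₂ m ≡ just v → ∃[ k ] v ≡ inj₂ k
mapMaybe-inj₂ (just k) refl = k , refl

⟦_⟧ : Bool → ℕ
⟦ b ⟧ = if b then 1 else 0

turn-count : ∀ x f f′ → ⟦ x ∧ f ∧ f′ ⟧ + (if f′ then 0 else ⟦ x ⟧) ≡ (if f then ⟦ x ⟧ else 0) + ⟦ x ∧ not f ∧ not f′ ⟧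
turn-count true  true  true  = refl
turn-count true  true  false = refl
turn-count true  false true  = refl
turn-count true  false false = refl
turn-count false true  true  = refl
turn-count false true  false = refl
turn-count false false true  = refl
turn-count false false false = refl

module Additive {A : Set} (h : List A → ℕ) (h-++ : ∀ xs ys → h (xs ++ ys) ≡ h xs + h ys) where
  open ≡-Reasoning
  open import Algebra.Properties.CommutativeSemigroup ℕ.+-commutativeSemigroup using (x∙yz≈y∙xz)

  ++-middle : ∀ P M R → h (P ++ M ++ R) ≡ h M + h (P ++ R)
  ++-middle P M R = begin
    h (P ++ M ++ R)      ≡⟨ h-++ P (M ++ R) ⟩
    h P + h (M ++ R)     ≡⟨ cong (λ m → h P + m) (h-++ M R) ⟩
    h P + (h M + h R)    ≡⟨ x∙yz≈y∙xz (h P) (h M) (h R) ⟩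
    h M + (h P + h R)    ≡⟨ cong (λ m → h M + m) (sym (h-++ P R)) ⟩
    h M + h (P ++ R)     ∎

  ++-middle₂ : ∀ P X Q Y R → h (P ++ X ++ Q ++ Y ++ R) ≡ h (X ++ Y) + (h Q + h (P ++ R))
  ++-middle₂ P X Q Y R = begin
    h (P ++ X ++ Q ++ Y ++ R)              ≡⟨ ++-middle P X (Q ++ Y ++ R) ⟩
    h X + h (P ++ Q ++ Y ++ R)             ≡⟨ cong (λ m → h X + m) (++-middle P Q (Y ++ R)) ⟩
    h X + (h Q + h (P ++ Y ++ R))          ≡⟨ cong (λ m → h X + (h Q + m)) (++-middle P Y R) ⟩
    h X + (h Q + (h Y + h (P ++ R)))       ≡⟨ regroup (h X) (h Q) (h Y) (h (P ++ R)) ⟩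
    (h X + h Y) + (h Q + h (P ++ R))       ≡⟨ cong (λ m → m + (h Q + h (P ++ R))) (sym (h-++ X Y)) ⟩
    h (X ++ Y) + (h Q + h (P ++ R))        ∎
    where
    regroup : ∀ x q y r → x + (q + (y + r)) ≡ (x + y) + (q + r)
    regroup = solve-∀

-- Sums around a cycle

csuc-fromℕ : ∀ n → csuc (fromℕ n) ≡ zero
csuc-fromℕ n with n ℕ.≟ toℕ (fromℕ n)
... | yes _   = refl
... | no n≢n = contradiction (sym (toℕ-fromℕ n)) n≢n

csuc-inject₁ : ∀ {n} (j : Fin n) → csuc (inject₁ j) ≡ suc j
csuc-inject₁ {n} j with n ℕ.≟ toℕ (inject₁ j)
... | yes n≡j = contradiction n≡j (toℕ-inject₁-≢ j)
... | no n≢j  = cong suc (lower₁-inject₁′ j n≢j)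

module CyclicSum {a ℓ} (M : CommutativeMonoid a ℓ) where
  open CommutativeMonoid M using (Carrier; _≈_; setoid; comm; ∙-congˡ)
    renaming (_∙_ to _+ᴹ_; sym to ≈-sym)
  open CommutativeMonoidSum M using (sum-init-last; sum-cong-≗; sum-cong-≋; ∑-distrib-+)
    renaming (sum to ∑)
  open import Relation.Binary.Reasoning.Setoid setoid

  ∑-csuc : ∀ {n} (f : Fin (suc n) → Carrier) → ∑ (f ∘ csuc) ≈ ∑ f
  ∑-csuc {n} f = begin
    ∑ (f ∘ csuc)                                  ≈⟨ sum-init-last (f ∘ csuc) ⟩
    ∑ (f ∘ csuc ∘ inject₁) +ᴹ f (csuc (fromℕ n))  ≡⟨ cong₂ _+ᴹ_ (sum-cong-≗ (cong f ∘ csuc-inject₁))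
                                                                (cong f (csuc-fromℕ n)) ⟩
    ∑ (f ∘ suc) +ᴹ f zero                         ≈⟨ comm _ _ ⟩
    ∑ f                                           ∎

  ∑-shift : ∀ {n} (f g f′ g′ : Fin (suc n) → Carrier) →
            (∀ i → f i +ᴹ g (csuc i) ≈ f′ i +ᴹ g′ i) →
            ∑ f +ᴹ ∑ g ≈ ∑ f′ +ᴹ ∑ g′
  ∑-shift f g f′ g′ eq = begin
    ∑ f +ᴹ ∑ g                   ≈⟨ ∙-congˡ (≈-sym (∑-csuc g)) ⟩
    ∑ f +ᴹ ∑ (g ∘ csuc)          ≈⟨ ≈-sym (∑-distrib-+ f (g ∘ csuc)) ⟩
    ∑ (λ i → f i +ᴹ g (csuc i))  ≈⟨ sum-cong-≋ eq ⟩
    ∑ (λ i → f′ i +ᴹ g′ i)       ≈⟨ ∑-distrib-+ f′ g′ ⟩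
    ∑ f′ +ᴹ ∑ g′                 ∎

open CyclicSum ℕ.+-0-commutativeMonoid using () renaming (∑-shift to ∑ℕ-shift)
open CyclicSum ℤ.+-0-commutativeMonoid using () renaming (∑-shift to ∑ℤ-shift)
open CommutativeMonoidSum ℕ.+-0-commutativeMonoid using () renaming (sum to ∑ℕ)
open CommutativeMonoidSum ℤ.+-0-commutativeMonoid using () renaming (sum to ∑ℤ)

∑ℕ-tabulate : ∀ {A : Set} {n} (f : A → ℕ) (g : Fin n → A) → sum (map f (tabulate g)) ≡ ∑ℕ (f ∘ g)
∑ℕ-tabulate {n = zero}  f g = refl
∑ℕ-tabulate {n = suc n} f g = cong (λ s → f (g zero) + s) (∑ℕ-tabulate f (g ∘ suc))

∑ℕ-lookup : ∀ {A : Set} (f : A → ℕ) (xs : List A) → ∑ℕ (f ∘ lookup xs) ≡ sum (map f xs)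
∑ℕ-lookup f xs = trans (sym (∑ℕ-tabulate f (lookup xs))) (cong (sum ∘ map f) (tabulate-lookup xs))

countF≡∑ℕ : ∀ {n} (b : Fin n → Bool) → countF b ≡ ∑ℕ (⟦_⟧ ∘ b)
countF≡∑ℕ b = ∑ℕ-tabulate (⟦_⟧ ∘ b) (λ i → i)

+-∑ℕ : ∀ {n} (f : Fin n → ℕ) → + ∑ℕ f ≡ ∑ℤ (+_ ∘ f)
+-∑ℕ {zero}  f = refl
+-∑ℕ {suc n} f = trans (ℤ.pos-+ (f zero) (∑ℕ (f ∘ suc))) (cong (λ s → + f zero ℤ.+ s) (+-∑ℕ (f ∘ suc)))

-- Closed walks in a graph weighted by its !, § and ? vertices

module ClosedWalks (G : Graph) (κ : Graph.V G → Kind)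
                   (_≟V_ : DecidableEquality (Graph.V G)) (_≟E_ : DecidableEquality (Graph.E G)) where
  open Graph G
  open ≡-Reasoning

  ε : V → ℕ
  ε v = ⟦ isExp (κ v) ⟧

  -- A step enters a !, § or ? link when it runs forward into it through a premise, and exits one
  -- when it runs backward out of it through a premise.  Passing such a link from premise to
  -- conclusion is an entry not followed by an exit, passing it from conclusion to premise an exit
  -- not preceded by an entry; so a cycle is !?-balanced iff it has as many entries as exits.
  entry exit : Step G → ℕ
  entry st = if Step.fwd st then ε (end G st) else 0
  exit  st = if Step.fwd st then 0 else ε (start G st)

  entry-exit-turn : ∀ st st′ → end G st ≡ start G st′ →
    ⟦ isExp (κ (end G st)) ∧ Step.fwd st ∧ Step.fwd st′ ⟧ + exit st′
      ≡ entry st + ⟦ isExp (κ (end G st)) ∧ not (Step.fwd st) ∧ not (Step.fwd st′) ⟧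
  entry-exit-turn st st′ meet rewrite meet = turn-count (isExp (κ (start G st′))) (Step.fwd st) (Step.fwd st′)

  module _ (cy : Cycle G) where
    open Cycle cy

    premiseToConclusion conclusionToPremise : Fin (suc len) → Bool
    premiseToConclusion i = isExp (κ (end G (step i))) ∧ Step.fwd (step i) ∧ Step.fwd (step (csuc i))
    conclusionToPremise i = isExp (κ (end G (step i))) ∧ not (Step.fwd (step i)) ∧ not (Step.fwd (step (csuc i)))

    entries exits : ℕ
    entries = ∑ℕ (entry ∘ step)
    exits   = ∑ℕ (exit ∘ step)

    cycle-turns : countF premiseToConclusion + exits ≡ entries + countF conclusionToPremise
    cycle-turns = begin
      countF premiseToConclusion + exits
        ≡⟨ cong (λ n → n + exits) (countF≡∑ℕ premiseToConclusion) ⟩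
      ∑ℕ (⟦_⟧ ∘ premiseToConclusion) + exits
        ≡⟨ ∑ℕ-shift (⟦_⟧ ∘ premiseToConclusion) (exit ∘ step) (entry ∘ step) (⟦_⟧ ∘ conclusionToPremise)
                   (λ i → entry-exit-turn (step i) (step (csuc i)) (chain i)) ⟩
      entries + ∑ℕ (⟦_⟧ ∘ conclusionToPremise)
        ≡⟨ cong (λ n → entries + n) (sym (countF≡∑ℕ conclusionToPremise)) ⟩
      entries + countF conclusionToPremise ∎

    balanced⇒entries≡exits : Balanced G κ cy → entries ≡ exits
    balanced⇒entries≡exits bal = sym (ℕ.+-cancelˡ-≡ (countF conclusionToPremise) exits entries (begin
      countF conclusionToPremise + exits  ≡⟨ cong (λ n → n + exits) (sym bal) ⟩
      countF premiseToConclusion + exits  ≡⟨ cycle-turns ⟩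
      entries + countF conclusionToPremise ≡⟨ ℕ.+-comm entries _ ⟩
      countF conclusionToPremise + entries ∎))

    entries≡exits⇒balanced : entries ≡ exits → Balanced G κ cy
    entries≡exits⇒balanced eq =
      ℕ.+-cancelʳ-≡ exits (countF premiseToConclusion) (countF conclusionToPremise) (begin
      countF premiseToConclusion + exits   ≡⟨ cycle-turns ⟩
      entries + countF conclusionToPremise ≡⟨ cong (λ n → n + countF conclusionToPremise) eq ⟩
      exits + countF conclusionToPremise   ≡⟨ ℕ.+-comm exits _ ⟩
      countF conclusionToPremise + exits   ∎)

  IsPotential : (V → ℤ) → Set
  IsPotential c = ∀ e {v} → t e ≡ just v → c (s e) ≡ c v ℤ.+ + ε v

  potential-step : ∀ {c} → IsPotential c → ∀ st → c (start G st) ℤ.+ + exit st ≡ c (end G st) ℤ.+ + entry st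
  potential-step pot record { edge = e ; isT = p ; fwd = true }  = trans (ℤ.+-identityʳ _) (pot e p)
  potential-step pot record { edge = e ; isT = p ; fwd = false } = sym (trans (ℤ.+-identityʳ _) (pot e p))

  potential⇒balanced : ∀ {c} → IsPotential c → ∀ cy → Balanced G κ cy
  potential⇒balanced {c} pot cy = entries≡exits⇒balanced cy (ℤ.+-injective (begin
      + entries cy                      ≡⟨ +-∑ℕ (entry ∘ step) ⟩
      ∑ℤ (+_ ∘ entry ∘ step)            ≡⟨ ∙-cancelʳ (∑ℤ levels) _ _ telescope ⟩
      ∑ℤ (+_ ∘ exit ∘ step)             ≡⟨ sym (+-∑ℕ (exit ∘ step)) ⟩
      + exits cy                        ∎))
    where
    open Cycle cy
    open import Algebra.Properties.Group (AbelianGroup.group ℤ.+-0-abelianGroup) using (∙-cancelʳ)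
    levels : Fin (suc len) → ℤ
    levels = c ∘ start G ∘ step
    step-telescopes : ∀ i → + entry (step i) ℤ.+ levels (csuc i) ≡ levels i ℤ.+ + exit (step i)
    step-telescopes i = sym (begin
      levels i ℤ.+ + exit (step i)               ≡⟨ potential-step {c} pot (step i) ⟩
      c (end G (step i)) ℤ.+ + entry (step i)     ≡⟨ cong (λ v → c v ℤ.+ + entry (step i)) (chain i) ⟩
      levels (csuc i) ℤ.+ + entry (step i)        ≡⟨ ℤ.+-comm (levels (csuc i)) _ ⟩
      + entry (step i) ℤ.+ levels (csuc i)        ∎)
    telescope : ∑ℤ (+_ ∘ entry ∘ step) ℤ.+ ∑ℤ levels ≡ ∑ℤ (+_ ∘ exit ∘ step) ℤ.+ ∑ℤ levels
    telescope = trans (∑ℤ-shift (+_ ∘ entry ∘ step) levels levels (+_ ∘ exit ∘ step) step-telescopes)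
                      (ℤ.+-comm (∑ℤ levels) _)

  Walk : V → List (Step G) → V → Set
  Walk a []         b = a ≡ b
  Walk a (st ∷ sts) b = start G st ≡ a × Walk (end G st) sts b

  walk-++⁺ : ∀ {a m b} xs {ys} → Walk a xs m → Walk m ys b → Walk a (xs ++ ys) b
  walk-++⁺ []       refl     w₂ = w₂
  walk-++⁺ (_ ∷ xs) (p , w₁) w₂ = p , walk-++⁺ xs w₁ w₂

  walk-++⁻ : ∀ {a b} xs {ys} → Walk a (xs ++ ys) b → ∃[ m ] Walk a xs m × Walk m ys b
  walk-++⁻ {a} []       w = a , refl , w
  walk-++⁻     (_ ∷ xs) (p , w) with walk-++⁻ xs w
  ... | m , w₁ , w₂ = m , (p , w₁) , w₂

  walk-segments : ∀ {a b} P st Q st′ R → Walk a (P ++ st ∷ Q ++ st′ ∷ R) b →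
    Walk a P (start G st) × Walk (end G st) Q (start G st′) × Walk (end G st′) R b
  walk-segments P st Q st′ R w with walk-++⁻ P w
  ... | _ , wP , (refl , w′) with walk-++⁻ Q w′
  ...   | _ , wQ , (refl , wR) = wP , wQ , wR

  reverseStep : Step G → Step G
  reverseStep st = record st { fwd = not (Step.fwd st) }

  start-reverseStep : ∀ st → start G (reverseStep st) ≡ end G st
  start-reverseStep record { fwd = true }  = refl
  start-reverseStep record { fwd = false } = refl

  end-reverseStep : ∀ st → end G (reverseStep st) ≡ start G st
  end-reverseStep record { fwd = true }  = refl
  end-reverseStep record { fwd = false } = refl

  entry-reverseStep : ∀ st → entry (reverseStep st) ≡ exit st
  entry-reverseStep record { fwd = true }  = refl
  entry-reverseStep record { fwd = false } = refl

  exit-reverseStep : ∀ st → exit (reverseStep st) ≡ entry st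
  exit-reverseStep record { fwd = true }  = refl
  exit-reverseStep record { fwd = false } = refl

  reverseWalk : List (Step G) → List (Step G)
  reverseWalk []         = []
  reverseWalk (st ∷ sts) = reverseWalk sts ++ [ reverseStep st ]

  walk-reverse : ∀ {a b} sts → Walk a sts b → Walk b (reverseWalk sts) a
  walk-reverse []         refl    = refl
  walk-reverse (st ∷ sts) (p , w) =
    walk-++⁺ (reverseWalk sts) (walk-reverse sts w) (start-reverseStep st , trans (end-reverseStep st) p)

  weight : (Step G → ℕ) → List (Step G) → ℕ
  weight f sts = sum (map f sts)

  weight-++ : ∀ f xs ys → weight f (xs ++ ys) ≡ weight f xs + weight f ys
  weight-++ f xs ys = trans (cong sum (map-++ f xs ys)) (sum-++ (map f xs) (map f ys))

  weight-cong : ∀ {f g} → f ≗ g → ∀ sts → weight f sts ≡ weight g sts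
  weight-cong f≗g sts = cong sum (map-cong f≗g sts)

  weight-reverseWalk : ∀ f sts → weight f (reverseWalk sts) ≡ weight (f ∘ reverseStep) sts
  weight-reverseWalk f []         = refl
  weight-reverseWalk f (st ∷ sts) = begin
    weight f (reverseWalk sts ++ [ reverseStep st ])         ≡⟨ weight-++ f (reverseWalk sts) _ ⟩
    weight f (reverseWalk sts) + (f (reverseStep st) + 0)    ≡⟨ cong₂ _+_ (weight-reverseWalk f sts) (ℕ.+-identityʳ _) ⟩
    weight (f ∘ reverseStep) sts + f (reverseStep st)        ≡⟨ ℕ.+-comm (weight (f ∘ reverseStep) sts) _ ⟩
    weight (f ∘ reverseStep) (st ∷ sts)                      ∎

  entries-reverseWalk : ∀ sts → weight entry (reverseWalk sts) ≡ weight exit sts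
  entries-reverseWalk sts = trans (weight-reverseWalk entry sts) (weight-cong entry-reverseStep sts)

  exits-reverseWalk : ∀ sts → weight exit (reverseWalk sts) ≡ weight entry sts
  exits-reverseWalk sts = trans (weight-reverseWalk exit sts) (weight-cong exit-reverseStep sts)

  BalancedWalk : List (Step G) → Set
  BalancedWalk sts = weight entry sts ≡ weight exit sts

  module Entries = Additive (weight entry) (weight-++ entry)
  module Exits   = Additive (weight exit) (weight-++ exit)
  module Length  = Additive {Step G} length (λ xs ys → length-++ xs)

  balanced-++-middle : ∀ P M R → BalancedWalk M → BalancedWalk (P ++ R) → BalancedWalk (P ++ M ++ R)
  balanced-++-middle P M R bal-M bal-PR = begin
    weight entry (P ++ M ++ R)                   ≡⟨ Entries.++-middle P M R ⟩
    weight entry M + weight entry (P ++ R)       ≡⟨ cong₂ _+_ bal-M bal-PR ⟩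
    weight exit M + weight exit (P ++ R)         ≡⟨ sym (Exits.++-middle P M R) ⟩
    weight exit (P ++ M ++ R)                    ∎

  balanced-++-middle₂ : ∀ P X Q Y R → BalancedWalk (X ++ Y) → BalancedWalk Q → BalancedWalk (P ++ R) →
                        BalancedWalk (P ++ X ++ Q ++ Y ++ R)
  balanced-++-middle₂ P X Q Y R bal-XY bal-Q bal-PR = begin
    weight entry (P ++ X ++ Q ++ Y ++ R)                               ≡⟨ Entries.++-middle₂ P X Q Y R ⟩
    weight entry (X ++ Y) + (weight entry Q + weight entry (P ++ R))   ≡⟨ cong₂ _+_ bal-XY (cong₂ _+_ bal-Q bal-PR) ⟩
    weight exit (X ++ Y) + (weight exit Q + weight exit (P ++ R))      ≡⟨ sym (Exits.++-middle₂ P X Q Y R) ⟩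
    weight exit (P ++ X ++ Q ++ Y ++ R)                                ∎

  data Repeats (st st′ : Step G) : Set where
    same-start : start G st ≡ start G st′ → Repeats st st′
    same-edge  : Step.edge st ≡ Step.edge st′ → Repeats st st′

  repeats? : ∀ st st′ → Dec (Repeats st st′)
  repeats? st st′ with start G st ≟V start G st′ | Step.edge st ≟E Step.edge st′
  ... | yes p  | _      = yes (same-start p)
  ... | no _   | yes q  = yes (same-edge q)
  ... | no ¬p  | no ¬q  = no λ { (same-start p) → ¬p p ; (same-edge q) → ¬q q }

  repeats-sym : Symmetric Repeats
  repeats-sym (same-start p) = same-start (sym p)
  repeats-sym (same-edge q)  = same-edge (sym q)

  RepetitionFree : List (Step G) → Set
  RepetitionFree = AllPairs (λ st st′ → ¬ Repeats st st′)

  record Repetition (sts : List (Step G)) : Set where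
    constructor repetition
    field
      P       : List (Step G)
      st      : Step G
      Q       : List (Step G)
      st′     : Step G
      R       : List (Step G)
      split   : sts ≡ P ++ st ∷ Q ++ st′ ∷ R
      repeats : Repeats st st′

  repetitionFree? : ∀ sts → RepetitionFree sts ⊎ Repetition sts
  repetitionFree? []         = inj₁ []
  repetitionFree? (st ∷ sts) with any? (repeats? st) sts
  ... | yes rep with find rep
  ...   | st′ , st′∈sts , r with ∈-∃++ st′∈sts
  ...     | Q , R , refl = inj₂ (repetition [] st Q st′ R refl r)
  repetitionFree? (st ∷ sts) | no ¬rep with repetitionFree? sts
  ... | inj₁ free = inj₁ (¬Any⇒All¬ sts ¬rep ∷ free)
  ... | inj₂ (repetition P st₁ Q st₂ R refl r) = inj₂ (repetition (st ∷ P) st₁ Q st₂ R refl r)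

  walk-lookup-inject₁ : ∀ {a b} st sts → Walk a (st ∷ sts) b → ∀ j →
                        end G (lookup (st ∷ sts) (inject₁ j)) ≡ start G (lookup sts j)
  walk-lookup-inject₁ st (st′ ∷ sts) (_ , p , _) zero    = sym p
  walk-lookup-inject₁ st (st′ ∷ sts) (_ , w)     (suc j) = walk-lookup-inject₁ st′ sts w j

  walk-lookup-last : ∀ {a b} st sts → Walk a (st ∷ sts) b → end G (lookup (st ∷ sts) (fromℕ (length sts))) ≡ b
  walk-lookup-last st []          (_ , p) = p
  walk-lookup-last st (st′ ∷ sts) (_ , w) = walk-lookup-last st′ sts w

  closedWalk-chain : ∀ {a} st sts → Walk a (st ∷ sts) a → ∀ {i} → View i →
                     end G (lookup (st ∷ sts) i) ≡ start G (lookup (st ∷ sts) (csuc i))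
  closedWalk-chain st sts w ‵fromℕ rewrite csuc-fromℕ (length sts) = trans (walk-lookup-last st sts w) (sym (proj₁ w))
  closedWalk-chain st sts w (‵inject₁ j) rewrite csuc-inject₁ j = walk-lookup-inject₁ st sts w j

  cycleOf : ∀ {a} st sts → Walk a (st ∷ sts) a → RepetitionFree (st ∷ sts) → Cycle G
  cycleOf st sts w free = record
    { len     = length sts
    ; step    = lookup (st ∷ sts)
    ; chain   = λ i → closedWalk-chain st sts w (view i)
    ; edgeInj = λ i j same → lookup-injective repeats-sym free i j (same-edge same)
    ; vertInj = λ i j same → lookup-injective repeats-sym free i j (same-start same)
    }

  shared-edge : ∀ st st′ → Step.edge st ≡ Step.edge st′ →
    start G st ≡ start G st′ ⊎ (end G st ≡ start G st′ × end G st′ ≡ start G st × BalancedWalk (st ∷ st′ ∷ []))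
  shared-edge record { other = v ; isT = p ; fwd = f } record { other = v′ ; isT = p′ ; fwd = f′ } refl
    with refl ← just-injective (trans (sym p) p′) | f | f′
  ... | true  | true  = inj₁ refl
  ... | false | false = inj₁ refl
  ... | true  | false = inj₂ (refl , refl , refl)
  ... | false | true  = inj₂ (refl , refl , refl)

  ShorterClosedWalksBalanced : List (Step G) → Set
  ShorterClosedWalksBalanced sts = ∀ {b} xs → length xs < length sts → Walk b xs b → BalancedWalk xs

  split-at-vertex : ∀ {a} P st Q st′ R → start G st ≡ start G st′ → Walk a (P ++ st ∷ Q ++ st′ ∷ R) a →
                    ShorterClosedWalksBalanced (P ++ st ∷ Q ++ st′ ∷ R) → BalancedWalk (P ++ st ∷ Q ++ st′ ∷ R)
  split-at-vertex P st Q st′ R same w shorter with walk-segments P st Q st′ R w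
  ... | wP , wQ , wR = balanced-++-middle P (st ∷ Q) (st′ ∷ R)
        (shorter (st ∷ Q) (subst (suc (length Q) <_) (sym lengths) (ℕ.m<m+n _ rest-nonempty))
                 (refl , subst (Walk (end G st) Q) (sym same) wQ))
        (shorter (P ++ st′ ∷ R) (subst (length (P ++ st′ ∷ R) <_) (sym lengths) (ℕ.m<n+m _ (s≤s z≤n)))
                 (walk-++⁺ P (subst (Walk _ P) same wP) (refl , wR)))
    where
    lengths : length (P ++ st ∷ Q ++ st′ ∷ R) ≡ suc (length Q) + length (P ++ st′ ∷ R)
    lengths = Length.++-middle P (st ∷ Q) (st′ ∷ R)
    rest-nonempty : 0 < length (P ++ st′ ∷ R)
    rest-nonempty = subst (0 <_) (sym (Length.++-middle P [ st′ ] R)) (s≤s z≤n)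

  split-at-reversal : ∀ {a} P st Q st′ R → end G st ≡ start G st′ → end G st′ ≡ start G st →
                      BalancedWalk (st ∷ st′ ∷ []) → Walk a (P ++ st ∷ Q ++ st′ ∷ R) a →
                      ShorterClosedWalksBalanced (P ++ st ∷ Q ++ st′ ∷ R) → BalancedWalk (P ++ st ∷ Q ++ st′ ∷ R)
  split-at-reversal P st Q st′ R there back bal-turn w shorter with walk-segments P st Q st′ R w
  ... | wP , wQ , wR = balanced-++-middle₂ P [ st ] Q [ st′ ] R bal-turn
        (shorter Q (subst (length Q <_) (sym lengths) (s≤s (ℕ.m≤n⇒m≤1+n (ℕ.m≤m+n _ _))))
                 (subst (Walk (end G st) Q) (sym there) wQ))
        (shorter (P ++ R) (subst (length (P ++ R) <_) (sym lengths) (s≤s (ℕ.m≤n⇒m≤1+n (ℕ.m≤n+m _ _))))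
                 (walk-++⁺ P wP (subst (λ x → Walk x R _) back wR)))
    where
    lengths : length (P ++ st ∷ Q ++ st′ ∷ R) ≡ 2 + (length Q + length (P ++ R))
    lengths = Length.++-middle₂ P [ st ] Q [ st′ ] R

  repetition-balanced : ∀ {a sts} → Repetition sts → Walk a sts a → ShorterClosedWalksBalanced sts → BalancedWalk sts
  repetition-balanced (repetition P st Q st′ R refl (same-start same)) = split-at-vertex P st Q st′ R same
  repetition-balanced (repetition P st Q st′ R refl (same-edge same)) with shared-edge st st′ same
  ... | inj₁ same                      = split-at-vertex P st Q st′ R same
  ... | inj₂ (there , back , bal-turn)  = split-at-reversal P st Q st′ R there back bal-turn

  module _ (cycles-balanced : ∀ cy → Balanced G κ cy) where

    repetitionFree-balanced : ∀ {a} sts → Walk a sts a → RepetitionFree sts → BalancedWalk sts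
    repetitionFree-balanced []         _ _    = refl
    repetitionFree-balanced (st ∷ sts) w free = begin
      weight entry (st ∷ sts)  ≡⟨ sym (∑ℕ-lookup entry (st ∷ sts)) ⟩
      entries cy               ≡⟨ balanced⇒entries≡exits cy (cycles-balanced cy) ⟩
      exits cy                 ≡⟨ ∑ℕ-lookup exit (st ∷ sts) ⟩
      weight exit (st ∷ sts)   ∎
      where cy = cycleOf st sts w free

    closedWalk-balanced : ∀ {a} sts → Walk a sts a → BalancedWalk sts
    closedWalk-balanced sts = go sts (<-wellFounded (length sts))
      where
      go : ∀ {a} sts → Acc _<_ (length sts) → Walk a sts a → BalancedWalk sts
      go sts (acc shorter) w with repetitionFree? sts
      ... | inj₁ free = repetitionFree-balanced sts w free
      ... | inj₂ rep  = repetition-balanced rep w (λ xs lt → go xs (shorter lt))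

  record Rooting : Set where
    field
      root      : V → V
      path      : V → List (Step G)
      path-walk : ∀ y → Walk (root y) (path y) y

  trivialRooting : Rooting
  trivialRooting = record { root = λ y → y ; path = λ _ → [] ; path-walk = λ _ → refl }

  Joins : Rooting → E → Set
  Joins ρ e = ∀ {v} → t e ≡ just v → Rooting.root ρ (s e) ≡ Rooting.root ρ v

  -- Re-root every vertex sharing a root with end st at the root of start st, reaching it through st.
  module Graft (ρ : Rooting) (st : Step G) where
    open Rooting ρ

    root′ : V → V
    root′ y with root y ≟V root (end G st)
    ... | yes _ = root (start G st)
    ... | no _  = root y

    path′ : V → List (Step G)
    path′ y with root y ≟V root (end G st)
    ... | yes _ = path (start G st) ++ st ∷ reverseWalk (path (end G st)) ++ path y
    ... | no _  = path y

    path′-walk : ∀ y → Walk (root′ y) (path′ y) y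
    path′-walk y with root y ≟V root (end G st)
    ... | yes same-root = walk-++⁺ (path (start G st)) (path-walk (start G st))
                            (refl , walk-++⁺ (reverseWalk (path (end G st))) (walk-reverse _ (path-walk (end G st)))
                                      (subst (λ r → Walk r (path y) y) same-root (path-walk y)))
    ... | no _          = path-walk y

    rooting : Rooting
    rooting = record { root = root′ ; path = path′ ; path-walk = path′-walk }

    root′-cong : ∀ {x y} → root x ≡ root y → root′ x ≡ root′ y
    root′-cong {x} {y} eq with root x ≟V root (end G st) | root y ≟V root (end G st)
    ... | yes _ | yes _  = refl
    ... | no _  | no _   = eq
    ... | yes p | no ¬q  = contradiction (trans (sym eq) p) ¬q
    ... | no ¬p | yes q  = contradiction (trans eq q) ¬p

    root′-joins : root′ (start G st) ≡ root′ (end G st)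
    root′-joins with root (start G st) ≟V root (end G st) | root (end G st) ≟V root (end G st)
    ... | _     | no ¬refl = contradiction refl ¬refl
    ... | yes _ | yes _    = refl
    ... | no _  | yes _    = refl

  rooting-joining : (es : List E) → Σ Rooting λ ρ → All (Joins ρ) es
  rooting-joining []       = trivialRooting , []
  rooting-joining (e ∷ es) with rooting-joining es | t e in te
  ... | ρ , joined | nothing = ρ , (λ p → contradiction (trans (sym te) p) λ ()) ∷ joined
  ... | ρ , joined | just v  = Graft.rooting ρ st , joins-e ∷ All.map (λ j {_} p → Graft.root′-cong ρ st (j p)) joined
    where
    st : Step G
    st = record { edge = e ; other = v ; isT = te ; fwd = true }
    joins-e : Joins (Graft.rooting ρ st) e
    joins-e p with refl ← just-injective (trans (sym te) p) = Graft.root′-joins ρ st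

  module _ (closed-balanced : ∀ {a} sts → Walk a sts a → BalancedWalk sts) (ρ : Rooting) where
    open Rooting ρ

    pathLevel : V → ℤ
    pathLevel y = weight exit (path y) ⊖ weight entry (path y)

    pathLevel-potential : ∀ e {v} → Joins ρ e → t e ≡ just v → pathLevel (s e) ≡ pathLevel v ℤ.+ + ε v
    pathLevel-potential e {v} joins p = begin
      Xu ⊖ Nu              ≡⟨ ⊖-cross {Xu} {Nu} {Xv + ε v} {Nv} cross ⟩
      (Xv + ε v) ⊖ Nv      ≡⟨ sym (ℤ.distribˡ-⊖-+-pos (ε v) Xv Nv) ⟩
      Xv ⊖ Nv ℤ.+ + ε v    ∎
      where
      Nu = weight entry (path (s e))
      Xu = weight exit (path (s e))
      Nv = weight entry (path v)
      Xv = weight exit (path v)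
      st : Step G
      st = record { edge = e ; other = v ; isT = p ; fwd = true }
      loop : List (Step G)
      loop = path (s e) ++ st ∷ reverseWalk (path v)
      loop-walk : Walk (root (s e)) loop (root (s e))
      loop-walk = walk-++⁺ (path (s e)) (path-walk (s e))
        (refl , subst (Walk v (reverseWalk (path v))) (sym (joins p)) (walk-reverse (path v) (path-walk v)))
      cross : Xu + Nv ≡ (Xv + ε v) + Nu
      cross = begin
        Xu + Nv                                           ≡⟨ cong (λ n → Xu + n) (sym (exits-reverseWalk (path v))) ⟩
        Xu + weight exit (st ∷ reverseWalk (path v))      ≡⟨ sym (weight-++ exit (path (s e)) _) ⟩
        weight exit loop                                  ≡⟨ sym (closed-balanced loop loop-walk) ⟩
        weight entry loop                                 ≡⟨ weight-++ entry (path (s e)) _ ⟩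
        Nu + (ε v + weight entry (reverseWalk (path v)))  ≡⟨ cong (λ n → Nu + (ε v + n)) (entries-reverseWalk (path v)) ⟩
        Nu + (ε v + Xv)                                   ≡⟨ ℕ.+-comm Nu _ ⟩
        (ε v + Xv) + Nu                                   ≡⟨ cong (λ n → n + Nu) (ℕ.+-comm (ε v) Xv) ⟩
        (Xv + ε v) + Nu                                   ∎

  balanced⇒potential : (∀ cy → Balanced G κ cy) → (es : List E) → (∀ e → e ∈ es) → Σ (V → ℤ) IsPotential
  balanced⇒potential cycles-balanced es complete with rooting-joining es
  ... | ρ , joined = pathLevel (closedWalk-balanced cycles-balanced) ρ ,
                     λ e → pathLevel-potential (closedWalk-balanced cycles-balanced) ρ e (All.lookup joined (complete e))

-- Levels of links and the ⅋-closure

Levelled : ℤ → (k : Kind) → Vec ℤ (nPrem k) → Vec ℤ (nConc k) → Set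
Levelled z k ps cs = (∀ i → Vec.lookup ps i ≡ z ℤ.+ + ⟦ isExp k ⟧) × (∀ j → Vec.lookup cs j ≡ z)

≡-level : ∀ {a c} → a ≡ c → a ≡ c ℤ.+ + 0
≡-level {c = c} a≡c = trans a≡c (sym (ℤ.+-identityʳ c))

level-≡ : ∀ {a c z} → a ≡ z ℤ.+ + 0 → c ≡ z → a ≡ c
level-≡ {z = z} a≡z c≡z = trans a≡z (trans (ℤ.+-identityʳ z) (sym c≡z))

level-suc : ∀ {a c z} → a ≡ z ℤ.+ ℤ.1ℤ → c ≡ z → a ≡ c ℤ.+ ℤ.1ℤ
level-suc a≡z+1 c≡z = trans a≡z+1 (cong (ℤ._+ ℤ.1ℤ) (sym c≡z))

idxOK⇒levelled : ∀ k ps cs → IdxOK k ps cs → Σ ℤ λ z → Levelled z k ps cs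
idxOK⇒levelled kAx     []           (a ∷ b ∷ []) a≡b         = a , (λ ()) , λ { zero → refl ; (suc zero) → sym a≡b }
idxOK⇒levelled kCut    (a ∷ b ∷ []) []           a≡b         = a , (λ { zero → ≡-level refl ; (suc zero) → ≡-level (sym a≡b) }) , λ ()
idxOK⇒levelled kOne    []           (c ∷ [])     _           = c , (λ ()) , λ { zero → refl }
idxOK⇒levelled kBot    []           (c ∷ [])     _           = c , (λ ()) , λ { zero → refl }
idxOK⇒levelled kTensor (a ∷ b ∷ []) (c ∷ [])     (a≡c , b≡c) = c , (λ { zero → ≡-level a≡c ; (suc zero) → ≡-level b≡c }) , λ { zero → refl }
idxOK⇒levelled kPar    (a ∷ b ∷ []) (c ∷ [])     (a≡c , b≡c) = c , (λ { zero → ≡-level a≡c ; (suc zero) → ≡-level b≡c }) , λ { zero → refl }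
idxOK⇒levelled kFlat   (a ∷ [])     (c ∷ [])     a≡c         = c , (λ { zero → ≡-level a≡c }) , λ { zero → refl }
idxOK⇒levelled kPax    (a ∷ [])     (c ∷ [])     a≡c         = c , (λ { zero → ≡-level a≡c }) , λ { zero → refl }
idxOK⇒levelled kOfc    (a ∷ [])     (c ∷ [])     a≡c+1       = c , (λ { zero → a≡c+1 }) , λ { zero → refl }
idxOK⇒levelled kPara   (a ∷ [])     (c ∷ [])     a≡c+1       = c , (λ { zero → a≡c+1 }) , λ { zero → refl }
idxOK⇒levelled (kWn n) ps           (c ∷ [])     ps≡c+1      = c , ps≡c+1 , λ { zero → refl }

levelled⇒idxOK : ∀ k ps cs z → Levelled z k ps cs → IdxOK k ps cs
levelled⇒idxOK kAx     []           (a ∷ b ∷ []) z (_ , cs)   = trans (cs zero) (sym (cs (suc zero)))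
levelled⇒idxOK kCut    (a ∷ b ∷ []) []           z (ps , _)   = trans (ps zero) (sym (ps (suc zero)))
levelled⇒idxOK kOne    []           (c ∷ [])     z _          = tt
levelled⇒idxOK kBot    []           (c ∷ [])     z _          = tt
levelled⇒idxOK kTensor (a ∷ b ∷ []) (c ∷ [])     z (ps , cs)  = level-≡ (ps zero) (cs zero) , level-≡ (ps (suc zero)) (cs zero)
levelled⇒idxOK kPar    (a ∷ b ∷ []) (c ∷ [])     z (ps , cs)  = level-≡ (ps zero) (cs zero) , level-≡ (ps (suc zero)) (cs zero)
levelled⇒idxOK kFlat   (a ∷ [])     (c ∷ [])     z (ps , cs)  = level-≡ (ps zero) (cs zero)
levelled⇒idxOK kPax    (a ∷ [])     (c ∷ [])     z (ps , cs)  = level-≡ (ps zero) (cs zero)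
levelled⇒idxOK kOfc    (a ∷ [])     (c ∷ [])     z (ps , cs)  = level-suc (ps zero) (cs zero)
levelled⇒idxOK kPara   (a ∷ [])     (c ∷ [])     z (ps , cs)  = level-suc (ps zero) (cs zero)
levelled⇒idxOK (kWn n) ps           (c ∷ [])     z (ps′ , cs) = λ i → level-suc (ps′ i) (cs zero)

combTgtNew-inject₁ : ∀ m (j : Fin m) → combTgtNew (suc (suc m)) (inject₁ j) ≡ just (suc j)
combTgtNew-inject₁ m j with m ℕ.≟ toℕ (inject₁ j)
... | yes m≡j = contradiction m≡j (toℕ-inject₁-≢ j)
... | no m≢j  = cong (just ∘ suc) (lower₁-inject₁′ j m≢j)

comb-constant : ∀ {A : Set} n (d : Fin (pred n) → A) → (∀ k {k′} → combTgtNew n k ≡ just k′ → d k ≡ d k′) →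
                ∀ k k′ → d k ≡ d k′
comb-constant (suc (suc m)) d step k k′ =
  trans (consecutive-constant d next k) (sym (consecutive-constant d next k′))
  where
  next : ∀ j → d (inject₁ j) ≡ d (suc j)
  next j = step (inject₁ j) (combTgtNew-inject₁ m j)

combTgtOrig-just : ∀ {n} j → 2 ≤ n → ∃[ k ] combTgtOrig n j ≡ just k
combTgtOrig-just {suc (suc m)} j _ = clamp m (j ∸ 1) , refl
combTgtOrig-just {suc zero} j (s≤s ())

module ⅋Closure (π : PreNet) (wf : WellFormed π) where
  open PreNet π
  open WellFormed wf
  open ClosedWalks (closGraph π) (closKind π) (≡-dec _≟ᶠ_ _≟ᶠ_) (≡-dec _≟ᶠ_ _≟ᶠ_)

  closTgt-premise : ∀ {e l} → tgt e ≡ just l → closTgt π (inj₁ e) ≡ just (inj₁ l)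
  closTgt-premise {e} te with tgt e
  closTgt-premise refl | just _ = refl

  closTgt-conclusion : ∀ {e} → tgt e ≡ nothing → 2 ≤ nC π → ∃[ k ] closTgt π (inj₁ e) ≡ just (inj₂ k)
  closTgt-conclusion {e} te two with tgt e
  closTgt-conclusion {e} refl two | nothing with combTgtOrig-just (indexOf e (netConcls π)) two
  ... | k , eq = k , cong (mapMaybe inj₂) eq

  is-conclusion : ∀ {e} → tgt e ≡ nothing → e ∈ netConcls π
  is-conclusion {e} te = ∈-filter⁺ (T? ∘ isNothing ∘ tgt) (∈-allFin e) (subst (T ∘ isNothing) (sym te) tt)

  conclusion-target : ∀ {e} → e ∈ netConcls π → tgt e ≡ nothing
  conclusion-target {e} e∈ with tgt e | proj₂ (∈-filter⁻ (T? ∘ isNothing ∘ tgt) {xs = allFin nE} e∈)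
  ... | nothing | _ = refl

  edges : List (Fin nE ⊎ Fin (pred (nC π)))
  edges = map inj₁ (allFin nE) ++ map inj₂ (allFin (pred (nC π)))

  ∈-edges : ∀ e → e ∈ edges
  ∈-edges (inj₁ e) = ∈-++⁺ˡ (∈-map⁺ inj₁ (∈-allFin e))
  ∈-edges (inj₂ k) = ∈-++⁺ʳ (map inj₁ (allFin nE)) (∈-map⁺ inj₂ (∈-allFin k))

  module FromIndexing (I : Fin nE → ℤ)
                      (I-links : ∀ l → IdxOK (kind l) (Vec.map I (prem l)) (Vec.map I (conc l)))
                      (I-concls : ∀ e e′ → tgt e ≡ nothing → tgt e′ ≡ nothing → I e ≡ I e′) where

    link-levelled : ∀ l → Σ ℤ λ z → Levelled z (kind l) (Vec.map I (prem l)) (Vec.map I (conc l))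
    link-levelled l = idxOK⇒levelled (kind l) _ _ (I-links l)

    linkLevel : Fin nL → ℤ
    linkLevel l = proj₁ (link-levelled l)

    premise-level : ∀ l i → I (Vec.lookup (prem l) i) ≡ linkLevel l ℤ.+ + ⟦ isExp (kind l) ⟧
    premise-level l i = trans (sym (lookup-map i I (prem l))) (proj₁ (proj₂ (link-levelled l)) i)

    source-level : ∀ e → linkLevel (src e) ≡ I e
    source-level e with src-conc e
    ... | j , conc-j≡e = begin
      linkLevel (src e)                           ≡⟨ sym (proj₂ (proj₂ (link-levelled (src e))) j) ⟩
      Vec.lookup (Vec.map I (conc (src e))) j     ≡⟨ lookup-map j I (conc (src e)) ⟩
      I (Vec.lookup (conc (src e)) j)             ≡⟨ cong I conc-j≡e ⟩
      I e                                         ∎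
      where open ≡-Reasoning

    uniformLevel : ∀ es → All (λ e → tgt e ≡ nothing) es → Σ ℤ λ z → ∀ {e} → e ∈ es → I e ≡ z
    uniformLevel []         _         = 0ℤ , λ ()
    uniformLevel (e₀ ∷ es) (t₀ ∷ ts) = I e₀ , λ e∈ → I-concls _ e₀ (All.lookup (t₀ ∷ ts) e∈) t₀

    conclusionLevel : ℤ
    conclusionLevel = proj₁ (uniformLevel (netConcls π) (All.tabulate conclusion-target))

    conclusion-level : ∀ e → tgt e ≡ nothing → I e ≡ conclusionLevel
    conclusion-level e te = proj₂ (uniformLevel (netConcls π) (All.tabulate conclusion-target)) (is-conclusion te)

    level : Fin nL ⊎ Fin (pred (nC π)) → ℤ
    level (inj₁ l) = linkLevel l
    level (inj₂ _) = conclusionLevel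

    level-potential : IsPotential level
    level-potential (inj₁ e) p with tgt e in te
    level-potential (inj₁ e) refl | just l with tgt-prem e l te
    ... | i , prem-i≡e = trans (source-level e) (trans (cong I (sym prem-i≡e)) (premise-level l i))
    level-potential (inj₁ e) p | nothing with mapMaybe-inj₂ (combTgtOrig (nC π) (indexOf e (netConcls π))) p
    ... | _ , refl = trans (source-level e) (≡-level (conclusion-level e te))
    level-potential (inj₂ k) p with mapMaybe-inj₂ (combTgtNew (nC π) k) p
    ... | _ , refl = ≡-level refl

  indexing⇒cyclesBalanced : ExpIndexing (π , wf) → AllCyclesBalanced (π , wf)
  indexing⇒cyclesBalanced (I , I-links , I-concls) =
    potential⇒balanced {FromIndexing.level I I-links I-concls} (FromIndexing.level-potential I I-links I-concls)

  module FromPotential (c : Fin nL ⊎ Fin (pred (nC π)) → ℤ) (pot : IsPotential c) where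

    I : Fin nE → ℤ
    I e = c (inj₁ (src e))

    I-links : ∀ l → IdxOK (kind l) (Vec.map I (prem l)) (Vec.map I (conc l))
    I-links l = levelled⇒idxOK (kind l) _ _ (c (inj₁ l)) (premises , conclusions)
      where
      premises : ∀ i → Vec.lookup (Vec.map I (prem l)) i ≡ c (inj₁ l) ℤ.+ + ⟦ isExp (kind l) ⟧
      premises i = trans (lookup-map i I (prem l)) (pot (inj₁ (Vec.lookup (prem l) i)) (closTgt-premise (prem-tgt l i)))
      conclusions : ∀ j → Vec.lookup (Vec.map I (conc l)) j ≡ c (inj₁ l)
      conclusions j = trans (lookup-map j I (conc l)) (cong (c ∘ inj₁) (conc-src l j))

    comb-level : ∀ k k′ → c (inj₂ k) ≡ c (inj₂ k′)
    comb-level = comb-constant (nC π) (c ∘ inj₂)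
      (λ k eq → trans (pot (inj₂ k) (cong (mapMaybe inj₂) eq)) (ℤ.+-identityʳ _))

    conclusion-in-comb : ∀ {e} → tgt e ≡ nothing → 2 ≤ nC π → ∃[ k ] I e ≡ c (inj₂ k)
    conclusion-in-comb te two with closTgt-conclusion te two
    ... | k , eq = k , trans (pot _ eq) (ℤ.+-identityʳ _)

    I-concls : ∀ e e′ → tgt e ≡ nothing → tgt e′ ≡ nothing → I e ≡ I e′
    I-concls e e′ te te′ with e ≟ᶠ e′
    ... | yes refl = refl
    ... | no e≢e′ with conclusion-in-comb te two | conclusion-in-comb te′ two
      where two = distinct-members (is-conclusion te) (is-conclusion te′) e≢e′
    ...   | k , Ie≡k | k′ , Ie′≡k′ = trans Ie≡k (trans (comb-level k k′) (sym Ie′≡k′))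

  cyclesBalanced⇒indexing : AllCyclesBalanced (π , wf) → ExpIndexing (π , wf)
  cyclesBalanced⇒indexing cycles-balanced with balanced⇒potential cycles-balanced edges ∈-edges
  ... | c , pot = I , I-links , I-concls
    where open FromPotential c pot

mainTheorem12 : (π : Net) → DRNet π →
    (L3 π → AllCyclesBalanced π) × (AllCyclesBalanced π → L3 π)
mainTheorem12 (π , wf) dr =
  indexing⇒cyclesBalanced ∘ proj₂ , λ balanced → dr , cyclesBalanced⇒indexing balanced
  where open ⅋Closure π wf
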